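{- Let $(G,\tau)$ be a $\mathrm{TempEuler}(k)$ instance such that every two consecutive times at any edge differ by at most $u$. If $(G,\tau)$ is temporally Eulerian, then $\mathrm{imw}(G,\tau)\le 2(k-1)u+1$.
   Context: A temporal graph is a pair $(G,\tau)$ where $G$ is a finite simple graph and $\tau: E(G)\to 2^{\mathbb{N}}$ assigns to each edge $e$ a finite set $\tau(e)$ of times at which $e$ is active; $(e,t)$ with $t\in\tau(e)$ is a time-edge. A (strict) temporal $(x,y)$-walk is a sequence of time-edges $(e_1,t_1),\dots,(e_n,t_n)$ with $e_1,\dots,e_n$ a walk from $x$ to $y$ in $G$ and $t_1<\dots<t_n$; closed if $x=y$. A temporal Eulerian circuit is a closed temporal walk whose edge sequence is an Euler circuit of $G$; $(G,\tau)$ is temporally Eulerian if it has one. A $\mathrm{TempEuler}(k)$ instance is a temporal graph with $|\tau(e)|\le k$ for all $e$. "Consecutive times" at $e$ are elements $t<t'$ of $\tau(e)$ with no element of $\tau(e)$ strictly between them. The interval-membership-width is $\mathrm{imw}(G,\tau)=\max_t|\{e\in E(G):\min\tau(e)\le t\le\max\tau(e)\}|$. -}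

module Defs where

open import Data.Nat using (ℕ; zero; suc; _+_; _*_; _∸_; _≤_; _<_; _≤ᵇ_)
open import Data.Bool using (Bool; true; false; _∧_)
open import Data.Fin using (Fin)
open import Data.List using (List; []; _∷_; map; length; allFin)
open import Data.Bool.ListAction using (any)
open import Data.List.Membership.Propositional using (_∈_)
open import Data.List.Relation.Unary.All using (All)
open import Data.List.Relation.Unary.Unique.Propositional using (Unique)
open import Data.List.Relation.Unary.Linked using (Linked)
open import Data.List.Relation.Binary.Permutation.Propositional using (_↭_)
open import Data.Product using (_×_; _,_; proj₁; proj₂; Σ; ∃)
open import Data.Sum using (_⊎_)
open import Relation.Binary.PropositionalEquality using (_≡_; _≢_)
open import Relation.Nullary using (¬_)

record SimpleGraph : Set where
  field
    n     : ℕ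
    m     : ℕ
    ends  : Fin m → Fin n × Fin n
    loopless : ∀ e → proj₁ (ends e) ≢ proj₂ (ends e)
    simple   : ∀ e f → (ends e ≡ ends f ⊎ ends e ≡ (proj₂ (ends f) , proj₁ (ends f))) → e ≡ f
open SimpleGraph public

Vertex : SimpleGraph → Set
Vertex G = Fin (n G)

Edge : SimpleGraph → Set
Edge G = Fin (m G)

Joins : (G : SimpleGraph) → Edge G → Vertex G → Vertex G → Set
Joins G e x y = ends G e ≡ (x , y) ⊎ ends G e ≡ (y , x)

Labelling : SimpleGraph → Set
Labelling G = Edge G → List ℕ

WellFormedLabelling : (G : SimpleGraph) → Labelling G → Set
WellFormedLabelling G τ = ∀ e → Unique (τ e)

TempEulerK : (k : ℕ) (G : SimpleGraph) → Labelling G → Set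
TempEulerK k G τ = WellFormedLabelling G τ × (∀ e → length (τ e) ≤ k)

data WalkSeq (G : SimpleGraph) : Vertex G → Vertex G → List (Edge G × ℕ) → Set where
  nil  : ∀ {x} → WalkSeq G x x []
  cons : ∀ {x z y e t ws} → Joins G e x z → WalkSeq G z y ws → WalkSeq G x y ((e , t) ∷ ws)

TemporalWalk : (G : SimpleGraph) → Labelling G → Vertex G → Vertex G → List (Edge G × ℕ) → Set
TemporalWalk G τ x y ws =
  WalkSeq G x y ws
  × All (λ p → proj₂ p ∈ τ (proj₁ p)) ws
  × Linked _<_ (map proj₂ ws)

TemporalEulerianCircuit : (G : SimpleGraph) → Labelling G → List (Edge G × ℕ) → Set
TemporalEulerianCircuit G τ ws =
  Σ (Vertex G) (λ x → TemporalWalk G τ x x ws) × (map proj₁ ws ↭ allFin (m G))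

TemporallyEulerian : (G : SimpleGraph) → Labelling G → Set
TemporallyEulerian G τ = ∃ λ ws → TemporalEulerianCircuit G τ ws

ConsecutiveGapsAtMost : (G : SimpleGraph) → Labelling G → ℕ → Set
ConsecutiveGapsAtMost G τ u =
  ∀ e a b → a ∈ τ e → b ∈ τ e → a < b
  → (∀ c → c ∈ τ e → ¬ (a < c × c < b))
  → b ∸ a ≤ u

-- min τ(e) ≤ t ≤ max τ(e), written as: some time of e is ≤ t and some is ≥ t.
activeSpan : (ts : List ℕ) → ℕ → Bool
activeSpan ts t = any (λ a → a ≤ᵇ t) ts ∧ any (λ b → t ≤ᵇ b) ts

countTrue : ∀ {A : Set} → (A → Bool) → List A → ℕ
countTrue p [] = 0
countTrue p (x ∷ xs) with p x
... | true  = suc (countTrue p xs)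
... | false = countTrue p xs

spanCount : (G : SimpleGraph) → Labelling G → ℕ → ℕ
spanCount G τ t = countTrue (λ e → activeSpan (τ e) t) (allFin (m G))

-- imw(G,τ) ≤ w  (imw is the maximum over t of spanCount)
ImwAtMost : (G : SimpleGraph) → Labelling G → ℕ → Set
ImwAtMost G τ w = ∀ t → spanCount G τ t ≤ w

{-# OPTIONS --safe #-}
-- An Euler circuit traverses each edge e exactly once, at some time s ∈ τ(e),
-- and its times are strictly increasing. Chaining at most k − 1 consecutive
-- gaps of size ≤ u, any two times of e differ by at most (k − 1)u, so if e is
-- alive at t (min τ(e) ≤ t ≤ max τ(e)) then |s − t| ≤ (k − 1)u. Distinct
-- traversals have distinct times, so at most 2(k − 1)u + 1 edges are alive at t.
module Submission where

open import Defs
open import Data.Nat using (ℕ; suc; _+_; _*_; _∸_; _≤_; _<_; _≤ᵇ_; z≤n; s≤s; _<?_)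
open import Data.Nat.Properties
open import Data.Nat.Induction using (<-wellFounded)
open import Data.Nat.Tactic.RingSolver using (solve-∀)
open import Data.Bool using (Bool; true; false; _∧_; T)
open import Data.Bool.Properties using (T-∧; T-≡)
open import Data.Empty using (⊥; ⊥-elim)
open import Data.Product using (_×_; _,_; proj₁; proj₂)
open import Data.Sum using (_⊎_; inj₁; inj₂)
open import Data.List using (List; []; _∷_; map; length; filterᵇ)
open import Data.List.Properties using (filter-notAll)
open import Data.List.Membership.Propositional using (_∈_; find; lose)
open import Data.List.Relation.Unary.Any using (Any; here; there; any?)
open import Data.List.Relation.Unary.Any.Properties using (any⁻)
import Data.List.Relation.Unary.All as All
open import Data.List.Relation.Unary.AllPairs using (AllPairs; []; _∷_)
open import Data.List.Relation.Unary.Linked.Properties using (Linked⇒AllPairs)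
open import Data.List.Relation.Binary.Permutation.Propositional using (_↭_; ↭-sym)
open import Data.List.Relation.Binary.Permutation.Propositional.Properties using (↭-length; filter-↭)
open import Function.Bundles using (Equivalence)
open import Induction.WellFounded using (Acc; acc)
open import Relation.Binary.PropositionalEquality using (_≡_; refl; sym; cong; subst; module ≡-Reasoning)
open import Relation.Nullary using (¬_; yes; no)
open import Relation.Nullary.Decidable using (_×-dec_)

module _ {A : Set} where

  countTrue≡length∘filterᵇ : (p : A → Bool) (xs : List A) → countTrue p xs ≡ length (filterᵇ p xs)
  countTrue≡length∘filterᵇ p [] = refl
  countTrue≡length∘filterᵇ p (x ∷ xs) with p x
  ... | true  = cong suc (countTrue≡length∘filterᵇ p xs)
  ... | false = countTrue≡length∘filterᵇ p xs

  countTrue-↭ : (p : A → Bool) {xs ys : List A} → xs ↭ ys → countTrue p xs ≡ countTrue p ys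
  countTrue-↭ p {xs} {ys} xs↭ys = begin
    countTrue p xs             ≡⟨ countTrue≡length∘filterᵇ p xs ⟩
    length (filterᵇ p xs)      ≡⟨ ↭-length (filter-↭ _ xs↭ys) ⟩
    length (filterᵇ p ys)      ≡⟨ sym (countTrue≡length∘filterᵇ p ys) ⟩
    countTrue p ys             ∎
    where open ≡-Reasoning

  countTrue<length : (p : A → Bool) {xs : List A} → Any (λ x → ¬ T (p x)) xs → countTrue p xs < length xs
  countTrue<length p {xs} any¬p =
    subst (_< length xs) (sym (countTrue≡length∘filterᵇ p xs)) (filter-notAll _ xs any¬p)

  countTrue-map : {B : Set} (p : B → Bool) (f : A → B) (xs : List A)
    → countTrue p (map f xs) ≡ countTrue (λ x → p (f x)) xs
  countTrue-map p f [] = refl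
  countTrue-map p f (x ∷ xs) with p (f x)
  ... | true  = cong suc (countTrue-map p f xs)
  ... | false = countTrue-map p f xs

  countTrue-pos : (p : A → Bool) {x : A} {xs : List A} → x ∈ xs → T (p x) → 0 < countTrue p xs
  countTrue-pos p {xs = y ∷ ys} x∈ px with p y in py
  ... | true = s≤s z≤n
  countTrue-pos p (here refl) px | false rewrite py = ⊥-elim px
  countTrue-pos p (there x∈) px | false = countTrue-pos p x∈ px

  countTrue-mono : (p q : A → Bool) (xs : List A)
    → (∀ {x} → x ∈ xs → T (p x) → T (q x)) → countTrue p xs ≤ countTrue q xs
  countTrue-mono p q [] p⇒q = z≤n
  countTrue-mono p q (x ∷ xs) p⇒q with p x in px | q x in qx
  ... | true  | true  = s≤s (countTrue-mono p q xs (λ x∈ → p⇒q (there x∈)))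
  ... | false | true  = m≤n⇒m≤1+n (countTrue-mono p q xs (λ x∈ → p⇒q (there x∈)))
  ... | false | false = countTrue-mono p q xs (λ x∈ → p⇒q (there x∈))
  ... | true  | false = ⊥-elim (subst T qx (p⇒q (here refl) (Equivalence.from T-≡ px)))

  countTrue-disjoint-+ : (p q r : A → Bool) (xs : List A)
    → (∀ x → T (p x) → T (q x) → ⊥) → (∀ x → T (p x) ⊎ T (q x) → T (r x))
    → countTrue p xs + countTrue q xs ≤ countTrue r xs
  countTrue-disjoint-+ p q r [] _ _ = z≤n
  countTrue-disjoint-+ p q r (x ∷ xs) disj cover with p x in px | q x in qx | r x in rx
  ... | true  | true  | _     = ⊥-elim (disj x (Equivalence.from T-≡ px) (Equivalence.from T-≡ qx))
  ... | true  | false | true  = s≤s (countTrue-disjoint-+ p q r xs disj cover)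
  ... | false | true  | true  = subst (_≤ suc (countTrue r xs)) (sym (+-suc (countTrue p xs) (countTrue q xs)))
                                  (s≤s (countTrue-disjoint-+ p q r xs disj cover))
  ... | false | false | true  = m≤n⇒m≤1+n (countTrue-disjoint-+ p q r xs disj cover)
  ... | false | false | false = countTrue-disjoint-+ p q r xs disj cover
  ... | true  | false | false = ⊥-elim (subst T rx (cover x (inj₁ (Equivalence.from T-≡ px))))
  ... | false | true  | false = ⊥-elim (subst T rx (cover x (inj₂ (Equivalence.from T-≡ qx))))

-- Opaque, so that lo, hi and s can be inferred from T (within lo hi s).
opaque
  within : ℕ → ℕ → ℕ → Bool
  within lo hi s = (lo ≤ᵇ s) ∧ (s ≤ᵇ hi)

opaque
  unfolding within

  within⁻ : ∀ {lo hi s} → T (within lo hi s) → lo ≤ s × s ≤ hi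
  within⁻ {lo} {hi} {s} inside with lo≤s , s≤hi ← Equivalence.to T-∧ inside =
    ≤ᵇ⇒≤ lo s lo≤s , ≤ᵇ⇒≤ s hi s≤hi

  within⁺ : ∀ {lo hi s} → lo ≤ s → s ≤ hi → T (within lo hi s)
  within⁺ lo≤s s≤hi = Equivalence.from T-∧ (≤⇒≤ᵇ lo≤s , ≤⇒≤ᵇ s≤hi)

countTrue-within-ascending : ∀ lo hi {xs} → AllPairs _<_ xs → countTrue (within lo hi) xs ≤ suc hi ∸ lo
countTrue-within-ascending lo hi [] = z≤n
countTrue-within-ascending lo hi {x ∷ xs} (x<xs ∷ ascending) with within lo hi x in inside
... | false = countTrue-within-ascending lo hi ascending
... | true with lo≤x , x≤hi ← within⁻ (Equivalence.from T-≡ inside) = begin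
  suc (countTrue (within lo hi) xs)      ≤⟨ s≤s (countTrue-mono _ _ xs raise) ⟩
  suc (countTrue (within (suc x) hi) xs) ≤⟨ s≤s (countTrue-within-ascending (suc x) hi ascending) ⟩
  suc (hi ∸ x)                           ≡⟨ sym (+-∸-assoc 1 x≤hi) ⟩
  suc hi ∸ x                             ≤⟨ ∸-monoʳ-≤ (suc hi) lo≤x ⟩
  suc hi ∸ lo                            ∎
  where
  open ≤-Reasoning
  raise : ∀ {s} → s ∈ xs → T (within lo hi s) → T (within (suc x) hi s)
  raise s∈ inside = within⁺ (All.lookup x<xs s∈) (proj₂ (within⁻ inside))

GapsAtMost : List ℕ → ℕ → Set
GapsAtMost L u = ∀ a b → a ∈ L → b ∈ L → a < b → (∀ c → c ∈ L → ¬ (a < c × c < b)) → b ∸ a ≤ u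

∸-split : ∀ {a b c} → a ≤ c → c ≤ b → b ∸ a ≡ (b ∸ c) + (c ∸ a)
∸-split {a} {b} {c} a≤c c≤b = begin
  b ∸ a             ≡⟨ cong (_∸ a) (sym (m∸n+n≡m c≤b)) ⟩
  (b ∸ c) + c ∸ a   ≡⟨ +-∸-assoc (b ∸ c) a≤c ⟩
  (b ∸ c) + (c ∸ a) ∎
  where open ≡-Reasoning

module _ {L : List ℕ} {u : ℕ} (gaps : GapsAtMost L u) where

  ∸≤countTrue-between*gap : ∀ {a b} → a ∈ L → b ∈ L → a < b → b ∸ a ≤ countTrue (within (suc a) b) L * u
  ∸≤countTrue-between*gap = go (<-wellFounded _)
    where
    go : ∀ {a b} → Acc _<_ (b ∸ a) → a ∈ L → b ∈ L → a < b → b ∸ a ≤ countTrue (within (suc a) b) L * u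
    go {a} {b} (acc shorter) a∈ b∈ a<b with any? (λ c → (a <? c) ×-dec (c <? b)) L
    ... | no nothingBetween = begin
      b ∸ a                              ≤⟨ gaps a b a∈ b∈ a<b (λ c c∈ a<c<b → nothingBetween (lose c∈ a<c<b)) ⟩
      u                                  ≡⟨ sym (*-identityˡ u) ⟩
      1 * u                              ≤⟨ *-monoˡ-≤ u (countTrue-pos _ b∈ (within⁺ a<b ≤-refl)) ⟩
      countTrue (within (suc a) b) L * u ∎
      where open ≤-Reasoning
    ... | yes somethingBetween with c , c∈ , (a<c , c<b) ← find somethingBetween = begin
      b ∸ a
        ≡⟨ ∸-split (<⇒≤ a<c) (<⇒≤ c<b) ⟩
      (b ∸ c) + (c ∸ a)
        ≤⟨ +-mono-≤ (go (shorter (∸-monoʳ-< a<c (<⇒≤ c<b))) c∈ b∈ c<b)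
                    (go (shorter (∸-monoˡ-< c<b (<⇒≤ a<c))) a∈ c∈ a<c) ⟩
      countTrue (within (suc c) b) L * u + countTrue (within (suc a) c) L * u
        ≡⟨ sym (*-distribʳ-+ u (countTrue (within (suc c) b) L) _) ⟩
      (countTrue (within (suc c) b) L + countTrue (within (suc a) c) L) * u
        ≤⟨ *-monoˡ-≤ u (countTrue-disjoint-+ _ _ _ L disjoint cover) ⟩
      countTrue (within (suc a) b) L * u
        ∎
      where
      open ≤-Reasoning
      disjoint : ∀ s → T (within (suc c) b s) → T (within (suc a) c s) → ⊥
      disjoint s right left = <⇒≱ (proj₁ (within⁻ right)) (proj₂ (within⁻ left))
      cover : ∀ s → T (within (suc c) b s) ⊎ T (within (suc a) c s) → T (within (suc a) b s)
      cover s (inj₁ right) with c<s , s≤b ← within⁻ right = within⁺ (<-trans a<c c<s) s≤b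
      cover s (inj₂ left) with a<s , s≤c ← within⁻ left = within⁺ a<s (≤-trans s≤c (<⇒≤ c<b))

  ∸≤[length∸1]*gap : ∀ {a b} → a ∈ L → b ∈ L → b ∸ a ≤ (length L ∸ 1) * u
  ∸≤[length∸1]*gap {a} {b} a∈ b∈ with a <? b
  ... | no a≮b = ≤-trans (≤-reflexive (m≤n⇒m∸n≡0 (≮⇒≥ a≮b))) z≤n
  ... | yes a<b = ≤-trans (∸≤countTrue-between*gap a∈ b∈ a<b) (*-monoˡ-≤ u (∸-monoˡ-≤ 1 countBetween<length))
    where
    countBetween<length : countTrue (within (suc a) b) L < length L
    countBetween<length = countTrue<length _ (lose a∈ (λ inside → <-irrefl refl (proj₁ (within⁻ inside))))

activeSpan⇒within : ∀ {ts d t s} → (∀ {a b} → a ∈ ts → b ∈ ts → b ∸ a ≤ d)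
  → s ∈ ts → T (activeSpan ts t) → T (within (t ∸ d) (t + d) s)
activeSpan⇒within {ts} {d} {t} {s} spread s∈ alive
  with someBefore , someAfter ← Equivalence.to T-∧ alive
  with a , a∈ , a≤ᵇt ← find (any⁻ _ ts someBefore)
     | b , b∈ , t≤ᵇb ← find (any⁻ _ ts someAfter) =
  within⁺ (m≤n+o⇒m∸n≤o t d t≤d+s) s≤t+d
  where
  open ≤-Reasoning
  t≤d+s : t ≤ d + s
  t≤d+s = begin
    t            ≤⟨ ≤ᵇ⇒≤ t b t≤ᵇb ⟩
    b            ≤⟨ m≤n+m∸n b s ⟩
    s + (b ∸ s)  ≤⟨ +-monoʳ-≤ s (spread s∈ b∈) ⟩
    s + d        ≡⟨ +-comm s d ⟩
    d + s        ∎
  s≤t+d : s ≤ t + d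
  s≤t+d = begin
    s            ≤⟨ m≤n+m∸n s a ⟩
    a + (s ∸ a)  ≤⟨ +-mono-≤ (≤ᵇ⇒≤ a t a≤ᵇt) (spread a∈ s∈) ⟩
    t + d        ∎

suc[t+d]∸[t∸d]≤2*d+1 : ∀ t d → suc (t + d) ∸ (t ∸ d) ≤ 2 * d + 1
suc[t+d]∸[t∸d]≤2*d+1 t d = m≤n+o⇒m∸n≤o (suc (t + d)) (t ∸ d) (begin
  suc (t + d)           ≤⟨ s≤s (+-monoˡ-≤ d (m≤n+m∸n t d)) ⟩
  suc (d + (t ∸ d) + d) ≡⟨ rearrange d (t ∸ d) ⟩
  (t ∸ d) + (2 * d + 1) ∎)
  where
  open ≤-Reasoning
  rearrange : ∀ d x → suc (d + x + d) ≡ x + (2 * d + 1)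
  rearrange = solve-∀

lemma5p2 : (k u : ℕ) (G : SimpleGraph) (τ : Labelling G)
    → TempEulerK k G τ
    → ConsecutiveGapsAtMost G τ u
    → TemporallyEulerian G τ
    → ImwAtMost G τ (2 * (k ∸ 1) * u + 1)
lemma5p2 k u G τ (_ , |τ|≤k) gaps (ws , (_ , _ , onTimes , ascending) , edges↭) t = begin
  spanCount G τ t                       ≡⟨ countTrue-↭ alive (↭-sym edges↭) ⟩
  countTrue alive (map proj₁ ws)        ≡⟨ countTrue-map alive proj₁ ws ⟩
  countTrue (λ p → alive (proj₁ p)) ws  ≤⟨ countTrue-mono _ _ ws traversedNear ⟩
  countTrue (λ p → near (proj₂ p)) ws   ≡⟨ sym (countTrue-map near proj₂ ws) ⟩
  countTrue near (map proj₂ ws)         ≤⟨ countTrue-within-ascending _ _ (Linked⇒AllPairs <-trans ascending) ⟩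
  suc (t + d) ∸ (t ∸ d)                 ≤⟨ suc[t+d]∸[t∸d]≤2*d+1 t d ⟩
  2 * d + 1                             ≡⟨ cong (_+ 1) (sym (*-assoc 2 (k ∸ 1) u)) ⟩
  2 * (k ∸ 1) * u + 1                   ∎
  where
  open ≤-Reasoning
  d : ℕ
  d = (k ∸ 1) * u
  alive : Edge G → Bool
  alive e = activeSpan (τ e) t
  near : ℕ → Bool
  near = within (t ∸ d) (t + d)
  spread : ∀ e {a b} → a ∈ τ e → b ∈ τ e → b ∸ a ≤ d
  spread e a∈ b∈ = ≤-trans (∸≤[length∸1]*gap (gaps e) a∈ b∈) (*-monoˡ-≤ u (∸-monoˡ-≤ 1 (|τ|≤k e)))
  traversedNear : ∀ {p} → p ∈ ws → T (alive (proj₁ p)) → T (near (proj₂ p))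
  traversedNear {e , _} p∈ = activeSpan⇒within (spread e) (All.lookup onTimes p∈)
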